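{- Let $\tau=\{R\}$ consist of a single relation symbol $R$. Any $\mathrm{GMMSNP}_{\neq}$ $\tau$-sentence $\Phi$ is logically equivalent to a $\mathrm{GMMSNP}_{\neq}$ $\tau$-sentence $\Psi$ such that, for any negated conjunct $\neg\psi_i$ of $\Psi$ and for any two different variables $x,y$ that appear within some $R$-atom of $\psi_i$, this conjunct contains the inequality $x\neq y$.
   Context: An $\mathrm{SNP}$ $\tau$-sentence is written in the form $\exists X_1,\ldots,X_s\,\forall \mathbf{x}\,\bigwedge_i \neg(\alpha_i\wedge\beta_i\wedge\epsilon_i)$, where $\sigma=\{X_1,\dots,X_s\}$ are existentially quantified relation symbols, each $\alpha_i$ a conjunction of (possibly negated) $\tau$-atoms, each $\beta_i$ a conjunction of (possibly negated) $\sigma$-atoms, and each $\epsilon_i$ a conjunction of inequalities $x\neq y$; each $\neg(\alpha_i\wedge\beta_i\wedge\epsilon_i)$ is a negated conjunct (and "the conjunct $\psi_i$ contains $x\neq y$" means $x\neq y$ is among the conjuncts of $\psi_i=\alpha_i\wedge\beta_i\wedge\epsilon_i$). $\mathrm{GMMSNP}_{\neq}$ is the class of such sentences where each $\alpha_i$ is a conjunction of nonnegated $\tau$-atoms, each $\beta_i$ is a conjunction of unary $\sigma$-atoms or negated unary $\sigma$-atoms, and for every inequality $x\neq x'$ in each $\epsilon_i$ there is a $\tau$-atom in $\alpha_i$ containing both $x$ and $x'$. Logical equivalence means being satisfied by exactly the same $\tau$-structures. -}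

module Defs where

open import Level using (Level; suc; zero)
open import Data.Nat using (ℕ)
open import Data.Fin using (Fin)
open import Data.Product using (Σ; _×_; _,_)
open import Data.Sum using (_⊎_)
open import Data.List using (List)
open import Data.List.Relation.Unary.All using (All)
open import Data.List.Relation.Unary.Any using (Any)
import Data.List.Membership.Propositional as LM
import Data.Vec.Membership.Propositional as VM
open import Data.Vec using (Vec; map)
open import Relation.Nullary using (¬_)
open import Relation.Binary.PropositionalEquality using (_≡_; _≢_)

-- Signature τ = {R} with R of arity k.
-- σ = {X₁,…,Xₛ} unary existentially quantified symbols, indexed by Fin s.
-- First-order variables x = (x₁,…,xₙ), indexed by Fin n.

data SLit (s n : ℕ) : Set where
  pos : Fin s → Fin n → SLit s n
  neg : Fin s → Fin n → SLit s n

record Conjunct (k s n : ℕ) : Set where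
  constructor conj
  field
    α : List (Vec (Fin n) k)        -- nonnegated R-atoms R(x_{a1},…,x_{ak})
    β : List (SLit s n)
    ε : List (Fin n × Fin n)        -- inequalities x_u ≠ x_v
open Conjunct public

InSameAtom : ∀ {k s n} → Conjunct k s n → Fin n → Fin n → Set
InSameAtom c x y = Any (λ a → x VM.∈ a × y VM.∈ a) (α c)

HasIneq : ∀ {k s n} → Conjunct k s n → Fin n → Fin n → Set
HasIneq c x y = ((x , y) LM.∈ ε c) ⊎ ((y , x) LM.∈ ε c)

WellGuarded : ∀ {k s n} → Conjunct k s n → Set
WellGuarded c = All (λ p → InSameAtom c (Data.Product.proj₁ p) (Data.Product.proj₂ p)) (ε c)

-- A GMMSNP≠ τ-sentence  ∃X₁…Xₛ ∀x₁…xₙ ⋀ᵢ ¬ψᵢ.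
record GMMSNPNeq (k : ℕ) : Set where
  constructor sentence
  field
    nσ        : ℕ
    nvars     : ℕ
    conjuncts : List (Conjunct k nσ nvars)
    guarded   : All WellGuarded conjuncts
open GMMSNPNeq public

record Structure (k : ℕ) : Set₁ where
  constructor struct
  field
    Dom : Set
    Rel : Vec Dom k → Set
open Structure public

module _ {k s n : ℕ} (𝔄 : Structure k) (X : Fin s → Dom 𝔄 → Set) (ν : Fin n → Dom 𝔄) where
  LitHolds : SLit s n → Set
  LitHolds (pos i v) = X i (ν v)
  LitHolds (neg i v) = ¬ X i (ν v)

  ConjHolds : Conjunct k s n → Set
  ConjHolds c =
    All (λ a → Rel 𝔄 (map ν a)) (α c) ×
    All LitHolds (β c) ×
    All (λ p → ν (Data.Product.proj₁ p) ≢ ν (Data.Product.proj₂ p)) (ε c)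

_⊨_ : ∀ {k} → Structure k → GMMSNPNeq k → Set₁
𝔄 ⊨ Φ =
  Σ (Fin (nσ Φ) → Dom 𝔄 → Set) λ X →
    (ν : Fin (nvars Φ) → Dom 𝔄) → All (λ c → ¬ ConjHolds 𝔄 X ν c) (conjuncts Φ)

LogEquiv : ∀ {k} → GMMSNPNeq k → GMMSNPNeq k → Set₁
LogEquiv Φ Ψ = (𝔄 : Structure _) → ((𝔄 ⊨ Φ → 𝔄 ⊨ Ψ) × (𝔄 ⊨ Ψ → 𝔄 ⊨ Φ))

AtomsSeparated : ∀ {k} → GMMSNPNeq k → Set
AtomsSeparated Ψ =
  All (λ c → (x y : Fin (nvars Ψ)) → x ≢ y → InSameAtom c x y → HasIneq c x y) (conjuncts Ψ)

-- Replace every conjunct ψ by all of its variable identifications ψ[σ] (σ ranging over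
-- all maps from the variables to themselves), each strengthened by x ≠ y for every pair
-- of distinct variables sharing an R-atom. A valuation ν satisfying such a conjunct makes
-- ψ true under ν ∘ σ, so Φ implies Ψ. Conversely, if ν makes ψ true, let σ send every
-- variable to a fixed representative of its ν-class: then ν satisfies ψ[σ], and distinct
-- variables in the image of σ take distinct values, so ν satisfies the strengthened
-- conjunct too. Choosing representatives needs equality of values to be decidable, which
-- holds up to double negation; that suffices because the goal is a negation.
module Submission where

open import Defs
open import Data.Nat using (ℕ; zero; suc)
open import Data.Product using (Σ; ∃; _×_; _,_; proj₁; proj₂)
open import Data.Fin using (Fin; zero; suc; _≟_)
open import Data.Fin.Properties using (sequence)
open import Data.Empty using (⊥-elim)
open import Data.List as List using (List; []; _∷_; _++_; allFin; concatMap; cartesianProduct; cartesianProductWith; filter)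
open import Data.List.Relation.Unary.All as All using (All)
open import Data.List.Relation.Unary.All.Properties using (map⁺; map⁻; ++⁺; ++⁻ˡ; concat⁺; concat⁻; all-filter)
open import Data.List.Relation.Unary.Any as Any using (Any)
import Data.List.Relation.Unary.Any.Properties as Anyₚ
open import Data.List.Membership.Propositional using (_∈_)
open import Data.List.Membership.Propositional.Properties
  using (∈-allFin; ∈-filter⁺; ∈-++⁺ʳ; ∈-cartesianProduct⁺; ∈-cartesianProductWith⁺)
open import Data.Vec as Vec using (Vec; lookup; tabulate)
open import Data.Vec.Properties using (map-∘; map-cong; lookup∘tabulate)
import Data.Vec.Membership.Propositional as VM
import Data.Vec.Membership.Propositional.Properties as VMₚ
import Data.Vec.Relation.Unary.Any as VAny
import Data.Vec.Relation.Unary.Any.Properties as VAnyₚ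
open import Data.Sum using (inj₁)
open import Effect.Monad using (RawMonad)
open import Function using (_∘_)
open import Relation.Nullary using (¬_; Dec; yes; no; contraposition)
open import Relation.Nullary.Decidable using (_×-dec_; ¬?; ¬¬-excluded-middle)
open import Relation.Nullary.Negation using (¬¬-Monad)
open import Relation.Binary.PropositionalEquality using (_≡_; _≢_; _≗_; refl; sym; trans; cong; subst)

allVecs : (n m : ℕ) → List (Vec (Fin n) m)
allVecs n zero    = Vec.[] ∷ []
allVecs n (suc m) = cartesianProductWith Vec._∷_ (allFin n) (allVecs n m)

∈-allVecs : ∀ {n m} (v : Vec (Fin n) m) → v ∈ allVecs n m
∈-allVecs Vec.[]       = Any.here refl
∈-allVecs (i Vec.∷ v) = ∈-cartesianProductWith⁺ Vec._∷_ (∈-allFin i) (∈-allVecs v)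

∈-map⁻ : ∀ {A B : Set} {m} (f : A → B) {y : B} (a : Vec A m) → y VM.∈ Vec.map f a → ∃ λ x → y ≡ f x
∈-map⁻ f a = VAny.satisfied ∘ VAnyₚ.map⁻

variablePairs : (n : ℕ) → List (Fin n × Fin n)
variablePairs n = cartesianProduct (allFin n) (allFin n)

¬¬-decidable : ∀ {D : Set} {n} (ν : Fin n → D) → ¬ ¬ (∀ x y → Dec (ν x ≡ ν y))
¬¬-decidable ν = sequence′ λ x → sequence′ λ y → ¬¬-excluded-middle
  where
    sequence′ : ∀ {m} {P : Fin m → Set} → (∀ i → ¬ ¬ P i) → ¬ ¬ (∀ i → P i)
    sequence′ = sequence (RawMonad.rawApplicative ¬¬-Monad)

record Normalises {D : Set} {n} (ν : Fin n → D) (σ : Fin n → Fin n) : Set where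
  field
    ν∘σ≗ν      : ν ∘ σ ≗ ν
    σ-respects : ∀ {x y} → ν x ≡ ν y → σ x ≡ σ y

  image-injective : ∀ {u w} → ν (σ u) ≡ ν (σ w) → σ u ≡ σ w
  image-injective e = σ-respects (trans (sym (ν∘σ≗ν _)) (trans e (ν∘σ≗ν _)))

normalises-≗ : ∀ {D : Set} {n} {ν : Fin n → D} {σ τ : Fin n → Fin n} →
               σ ≗ τ → Normalises ν σ → Normalises ν τ
normalises-≗ {ν = ν} σ≗τ N = record
  { ν∘σ≗ν      = λ x → trans (cong ν (sym (σ≗τ x))) (ν∘σ≗ν x)
  ; σ-respects = λ {x} {y} e → trans (sym (σ≗τ x)) (trans (σ-respects e) (σ≗τ y))
  }
  where open Normalises N

normaliser : ∀ {D : Set} {n} (ν : Fin n → D) → (∀ x y → Dec (ν x ≡ ν y)) → ∃ (Normalises ν)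
normaliser {n = zero}  ν _    = (λ ()) , record { ν∘σ≗ν = λ () ; σ-respects = λ { {()} } }
normaliser {n = suc n} ν _≟ν_ = σ , record { ν∘σ≗ν = ν∘σ≗ν ; σ-respects = σ-respects }
  where
    rest : ∃ (Normalises (ν ∘ suc))
    rest = normaliser (ν ∘ suc) (λ x y → suc x ≟ν suc y)

    σ′ : Fin n → Fin n
    σ′ = proj₁ rest
    open Normalises (proj₂ rest) renaming (ν∘σ≗ν to ν∘σ′≗ν; σ-respects to σ′-respects)

    σ : Fin (suc n) → Fin (suc n)
    σ zero = zero
    σ (suc i) with suc i ≟ν zero
    ... | yes _ = zero
    ... | no _  = suc (σ′ i)

    ν∘σ≗ν : ν ∘ σ ≗ ν
    ν∘σ≗ν zero = refl
    ν∘σ≗ν (suc i) with suc i ≟ν zero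
    ... | yes e = sym e
    ... | no _  = ν∘σ′≗ν i

    σ-respects : ∀ {x y} → ν x ≡ ν y → σ x ≡ σ y
    σ-respects {zero}  {zero}  _ = refl
    σ-respects {zero}  {suc j} e with suc j ≟ν zero
    ... | yes _ = refl
    ... | no ne = ⊥-elim (ne (sym e))
    σ-respects {suc i} {zero}  e with suc i ≟ν zero
    ... | yes _ = refl
    ... | no ne = ⊥-elim (ne e)
    σ-respects {suc i} {suc j} e with suc i ≟ν zero | suc j ≟ν zero
    ... | yes _  | yes _  = refl
    ... | yes ei | no nej = ⊥-elim (nej (trans (sym e) ei))
    ... | no nei | yes ej = ⊥-elim (nei (trans e ej))
    ... | no _   | no _   = cong suc (σ′-respects e)

renameLit : ∀ {s n m} → (Fin n → Fin m) → SLit s n → SLit s m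
renameLit σ (pos i x) = pos i (σ x)
renameLit σ (neg i x) = neg i (σ x)

module _ {k s : ℕ} where

  rename : ∀ {n m} → (Fin n → Fin m) → Conjunct k s n → Conjunct k s m
  rename σ c = conj (List.map (Vec.map σ) (α c))
                    (List.map (renameLit σ) (β c))
                    (List.map (λ (x , y) → σ x , σ y) (ε c))

  sameAtom-rename⁺ : ∀ {n m} (σ : Fin n → Fin m) (c : Conjunct k s n) {x y} →
                     InSameAtom c x y → InSameAtom (rename σ c) (σ x) (σ y)
  sameAtom-rename⁺ σ c = Anyₚ.map⁺ ∘ Any.map (λ (x∈ , y∈) → VMₚ.∈-map⁺ σ x∈ , VMₚ.∈-map⁺ σ y∈)

  sameAtom-rename⁻ : ∀ {n m} (σ : Fin n → Fin m) (c : Conjunct k s n) {x y} →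
                     InSameAtom (rename σ c) x y → (∃ λ u → x ≡ σ u) × (∃ λ w → y ≡ σ w)
  sameAtom-rename⁻ σ c sa with Any.satisfied (Anyₚ.map⁻ sa)
  ... | a , x∈ , y∈ = ∈-map⁻ σ a x∈ , ∈-map⁻ σ a y∈

  rename-guarded : ∀ {n m} (σ : Fin n → Fin m) (c : Conjunct k s n) →
                   WellGuarded c → WellGuarded (rename σ c)
  rename-guarded σ c = map⁺ ∘ All.map (sameAtom-rename⁺ σ c)

  module _ {n : ℕ} where
    open import Data.Vec.Membership.DecPropositional (_≟_ {n}) using (_∈?_)

    Separable : Conjunct k s n → Fin n × Fin n → Set
    Separable c (x , y) = x ≢ y × InSameAtom c x y

    separable? : ∀ c p → Dec (Separable c p)
    separable? c (x , y) = ¬? (x ≟ y) ×-dec Any.any? (λ a → (x ∈? a) ×-dec (y ∈? a)) (α c)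

    separate : Conjunct k s n → Conjunct k s n
    separate c = conj (α c) (β c) (ε c ++ filter (separable? c) (variablePairs n))

    separate-guarded : ∀ c → WellGuarded c → WellGuarded (separate c)
    separate-guarded c wg = ++⁺ wg (All.map proj₂ (all-filter (separable? c) (variablePairs n)))

    separate-separates : ∀ c (x y : Fin n) → x ≢ y → InSameAtom (separate c) x y → HasIneq (separate c) x y
    separate-separates c x y x≢y sa =
      inj₁ (∈-++⁺ʳ (ε c) (∈-filter⁺ (separable? c) (∈-cartesianProduct⁺ (∈-allFin x) (∈-allFin y)) (x≢y , sa)))

module _ {k s : ℕ} (𝔄 : Structure k) (X : Fin s → Dom 𝔄 → Set) where

  holds-cong : ∀ {n} {μ ν : Fin n → Dom 𝔄} (c : Conjunct k s n) →
               μ ≗ ν → ConjHolds 𝔄 X μ c → ConjHolds 𝔄 X ν c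
  holds-cong {μ = μ} {ν} c μ≗ν (atoms , lits , ineqs) =
    All.map (λ {a} → subst (Rel 𝔄) (map-cong μ≗ν a)) atoms ,
    All.map (λ {l} → lit l) lits ,
    All.map (λ {(x , y)} ne e → ne (trans (μ≗ν x) (trans e (sym (μ≗ν y))))) ineqs
    where
      lit : ∀ l → LitHolds 𝔄 X μ l → LitHolds 𝔄 X ν l
      lit (pos i x) = subst (X i) (μ≗ν x)
      lit (neg i x) = contraposition (subst (X i) (sym (μ≗ν x)))

  litHolds-rename : ∀ {n m} (ν : Fin m → Dom 𝔄) (σ : Fin n → Fin m) (l : SLit s n) →
                    LitHolds 𝔄 X ν (renameLit σ l) ≡ LitHolds 𝔄 X (ν ∘ σ) l
  litHolds-rename ν σ (pos i x) = refl
  litHolds-rename ν σ (neg i x) = refl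

  rename-holds⁻ : ∀ {n m} (ν : Fin m → Dom 𝔄) (σ : Fin n → Fin m) (c : Conjunct k s n) →
                  ConjHolds 𝔄 X ν (rename σ c) → ConjHolds 𝔄 X (ν ∘ σ) c
  rename-holds⁻ ν σ c (atoms , lits , ineqs) =
    All.map (λ {a} → subst (Rel 𝔄) (sym (map-∘ ν σ a))) (map⁻ atoms) ,
    All.map (λ {l} → subst (λ P → P) (litHolds-rename ν σ l)) (map⁻ lits) ,
    map⁻ ineqs

  rename-holds⁺ : ∀ {n m} (ν : Fin m → Dom 𝔄) (σ : Fin n → Fin m) (c : Conjunct k s n) →
                  ConjHolds 𝔄 X (ν ∘ σ) c → ConjHolds 𝔄 X ν (rename σ c)
  rename-holds⁺ ν σ c (atoms , lits , ineqs) =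
    map⁺ (All.map (λ {a} → subst (Rel 𝔄) (map-∘ ν σ a)) atoms) ,
    map⁺ (All.map (λ {l} → subst (λ P → P) (sym (litHolds-rename ν σ l))) lits) ,
    map⁺ ineqs

  separate-holds⁻ : ∀ {n} (ν : Fin n → Dom 𝔄) (c : Conjunct k s n) →
                    ConjHolds 𝔄 X ν (separate c) → ConjHolds 𝔄 X ν c
  separate-holds⁻ ν c (atoms , lits , ineqs) = atoms , lits , ++⁻ˡ (ε c) ineqs

  separate-holds⁺ : ∀ {n} (ν : Fin n → Dom 𝔄) (c : Conjunct k s n) →
                    (∀ {x y} → x ≢ y → InSameAtom c x y → ν x ≢ ν y) →
                    ConjHolds 𝔄 X ν c → ConjHolds 𝔄 X ν (separate c)
  separate-holds⁺ ν c sep (atoms , lits , ineqs) =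
    atoms , lits , ++⁺ ineqs (All.map (λ (x≢y , sa) → sep x≢y sa) (all-filter (separable? c) (variablePairs _)))

  normalised-holds : ∀ {n} {ν : Fin n → Dom 𝔄} {σ : Fin n → Fin n} (c : Conjunct k s n) →
                     Normalises ν σ → ConjHolds 𝔄 X ν c → ConjHolds 𝔄 X ν (separate (rename σ c))
  normalised-holds {ν = ν} {σ} c N =
    separate-holds⁺ ν (rename σ c) image-separated ∘ rename-holds⁺ ν σ c ∘ holds-cong c (sym ∘ ν∘σ≗ν)
    where
      open Normalises N
      image-separated : ∀ {x y} → x ≢ y → InSameAtom (rename σ c) x y → ν x ≢ ν y
      image-separated x≢y sa e with sameAtom-rename⁻ σ c sa
      ... | (u , refl) , (w , refl) = x≢y (image-injective e)

module _ {k s n : ℕ} where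

  separatedInstances : Conjunct k s n → List (Conjunct k s n)
  separatedInstances c = List.map (λ v → separate (rename (lookup v) c)) (allVecs n n)

  instances⁺ : {P : Conjunct k s n → Set} (cs : List (Conjunct k s n)) →
               (∀ {c} → c ∈ cs → ∀ v → P (separate (rename (lookup v) c))) →
               All P (concatMap separatedInstances cs)
  instances⁺ cs h = concat⁺ (map⁺ (All.tabulate λ c∈ → map⁺ (All.tabulate λ {v} _ → h c∈ v)))

  instances⁻ : {P : Conjunct k s n → Set} {cs : List (Conjunct k s n)} →
               All P (concatMap separatedInstances cs) →
               ∀ {c} → c ∈ cs → ∀ v → P (separate (rename (lookup v) c))
  instances⁻ h c∈ v = All.lookup (map⁻ (All.lookup (map⁻ (concat⁻ h)) c∈)) (∈-allVecs v)

normalise : ∀ {k} → GMMSNPNeq k → GMMSNPNeq k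
normalise (sentence s n cs guarded) =
  sentence s n (concatMap separatedInstances cs)
    (instances⁺ {P = WellGuarded} cs λ {c} c∈ v →
      separate-guarded (rename (lookup v) c) (rename-guarded (lookup v) c (All.lookup guarded c∈)))

normalise-separated : ∀ {k} (Φ : GMMSNPNeq k) → AtomsSeparated (normalise Φ)
normalise-separated (sentence s n cs _) = instances⁺ cs λ {c} _ v → separate-separates (rename (lookup v) c)

normalise-equiv : ∀ {k} (Φ : GMMSNPNeq k) → LogEquiv Φ (normalise Φ)
normalise-equiv Φ@(sentence s n cs _) 𝔄 = to , from
  where
    to : 𝔄 ⊨ Φ → 𝔄 ⊨ normalise Φ
    to (X , H) = X , λ ν → instances⁺ cs λ {c} c∈ v →
      All.lookup (H (ν ∘ lookup v)) c∈ ∘ rename-holds⁻ 𝔄 X ν (lookup v) c ∘ separate-holds⁻ 𝔄 X ν _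

    from : 𝔄 ⊨ normalise Φ → 𝔄 ⊨ Φ
    from (X , H) = X , λ ν → All.tabulate λ {c} c∈ holds → ¬¬-decidable ν λ dec →
      let (σ , N) = normaliser ν dec
      in instances⁻ (H ν) c∈ (tabulate σ)
           (normalised-holds 𝔄 X c (normalises-≗ (sym ∘ lookup∘tabulate σ) N) holds)

lemma1 : (k : ℕ) (Φ : GMMSNPNeq k) → Σ (GMMSNPNeq k) (λ Ψ → LogEquiv Φ Ψ × AtomsSeparated Ψ)
lemma1 k Φ = normalise Φ , normalise-equiv Φ , normalise-separated Φ
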